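{- Let $G$ be a connected graph of order $n$ with maximum degree $\Delta(G)$, and let $M(G)$ be its middle graph. Then: (1) If $n\geq 3$, then $D(M(G))\leq \Delta(G)$; moreover this bound is sharp, i.e. there are connected graphs $G$ of order at least $3$ with $D(M(G))=\Delta(G)$. (2) $D'(M(G))\leq 3$ for every positive integer $n$.
   Context: All graphs are simple, finite, undirected. The middle graph $M(G)$ has vertex set $V(G)\cup E(G)$; a vertex $v\in V(G)$ is adjacent to an element $e\in E(G)$ iff $v$ is an endpoint of $e$, two elements $e,e'\in E(G)$ are adjacent iff they share an endpoint in $G$, and no two vertices of $V(G)$ are adjacent (equivalently, $M(G)$ is obtained from the subdivision graph of $G$ by joining pairs of subdivision vertices lying on adjacent edges of $G$). The distinguishing number $D(H)$ (resp. distinguishing index $D'(H)$) of a graph $H$ is the least $d$ such that $H$ has a vertex coloring (resp. edge coloring), not necessarily proper, with $d$ colors that is preserved only by the identity automorphism, where an automorphism $\phi$ preserves a coloring $f$ if $f(\phi(x))=f(x)$ for every colored element $x$. -}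

module Defs where

open import Data.Nat using (ℕ; zero; suc; _<_; _<ᵇ_; _⊔_)
open import Data.Fin using (Fin; toℕ; _≟_)
open import Data.Bool using (Bool; true; false; T; _∧_; _∨_; not; if_then_else_)
open import Data.Sum using (_⊎_; inj₁; inj₂)
open import Data.Product using (Σ; _×_; _,_; proj₁; proj₂; ∃)
open import Data.List using (List; allFin; map; foldr)
open import Data.Nat.ListAction using (sum)
open import Relation.Binary.PropositionalEquality using (_≡_)
open import Relation.Nullary using (¬_)
open import Relation.Nullary.Decidable using (⌊_⌋)

AdjRel : Set → Set
AdjRel V = V → V → Bool

record SimpleGraph (n : ℕ) : Set where
  field
    adj    : AdjRel (Fin n)
    sym    : ∀ u v → adj u v ≡ adj v u
    irrefl : ∀ v → adj v v ≡ false
open SimpleGraph public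

data Reachable {n : ℕ} (G : SimpleGraph n) : Fin n → Fin n → Set where
  here : ∀ {x} → Reachable G x x
  step : ∀ {x y z} → T (adj G x y) → Reachable G y z → Reachable G x z

Connected : {n : ℕ} → SimpleGraph n → Set
Connected {n} G = ∀ (x y : Fin n) → Reachable G x y

-- Degree and maximum degree Δ(G) (Δ = 0 for the empty graph of order 0).
degree : {n : ℕ} → SimpleGraph n → Fin n → ℕ
degree {n} G v = sum (map (λ u → if adj G v u then 1 else 0) (allFin n))

maxDegree : {n : ℕ} → SimpleGraph n → ℕ
maxDegree {n} G = foldr _⊔_ 0 (map (degree G) (allFin n))

-- Edges of G: pairs (a , b) with a < b and a adjacent to b
-- (each edge {a,b} represented exactly once).
Edge : {n : ℕ} → SimpleGraph n → Set
Edge {n} G = Σ (Fin n × Fin n) λ p →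
  T (adj G (proj₁ p) (proj₂ p) ∧ (toℕ (proj₁ p) <ᵇ toℕ (proj₂ p)))

_==_ : {n : ℕ} → Fin n → Fin n → Bool
_==_ {n} a b = ⌊ a ≟ b ⌋

-- Vertex set of the middle graph: V(G) ∪ E(G).
MVertex : {n : ℕ} → SimpleGraph n → Set
MVertex {n} G = Fin n ⊎ Edge G

middleAdj : {n : ℕ} (G : SimpleGraph n) → AdjRel (MVertex G)
middleAdj {n} G (inj₁ v) (inj₁ w) = false
middleAdj {n} G (inj₁ v) (inj₂ ((a , b) , _)) = (v == a) ∨ (v == b)
middleAdj {n} G (inj₂ ((a , b) , _)) (inj₁ v) = (v == a) ∨ (v == b)
middleAdj {n} G (inj₂ ((a , b) , _)) (inj₂ ((a' , b') , _)) =
  not ((a == a') ∧ (b == b'))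
  ∧ ((a == a') ∨ (a == b') ∨ (b == a') ∨ (b == b'))

record Automorphism {V : Set} (A : AdjRel V) : Set where
  field
    fun      : V → V
    inv      : V → V
    inverseˡ : ∀ x → fun (inv x) ≡ x
    inverseʳ : ∀ x → inv (fun x) ≡ x
    preserve : ∀ x y → A (fun x) (fun y) ≡ A x y
open Automorphism public

IsIdentity : {V : Set} {A : AdjRel V} → Automorphism A → Set
IsIdentity {V} σ = ∀ (x : V) → fun σ x ≡ x

IsDistinguishingVertexColoring : {V : Set} (A : AdjRel V) (d : ℕ) → (V → Fin d) → Set
IsDistinguishingVertexColoring {V} A d c =
  ∀ (σ : Automorphism A) → (∀ x → c (fun σ x) ≡ c x) → IsIdentity σ

DistNumberLE : {V : Set} → AdjRel V → ℕ → Set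
DistNumberLE {V} A d = ∃ λ (c : V → Fin d) → IsDistinguishingVertexColoring A d c

DistNumberEq : {V : Set} → AdjRel V → ℕ → Set
DistNumberEq A d = DistNumberLE A d × (∀ k → k < d → ¬ DistNumberLE A k)

-- An edge coloring with d colors: a symmetric function on pairs of
-- vertices (only its values on edges matter).
record EdgeColoring {V : Set} (A : AdjRel V) (d : ℕ) : Set where
  field
    col    : V → V → Fin d
    colSym : ∀ x y → col x y ≡ col y x
open EdgeColoring public

IsDistinguishingEdgeColoring : {V : Set} (A : AdjRel V) (d : ℕ) → EdgeColoring A d → Set
IsDistinguishingEdgeColoring A d c =
  ∀ (σ : Automorphism A) →
    (∀ x y → T (A x y) → col c (fun σ x) (fun σ y) ≡ col c x y) → IsIdentity σ

DistIndexLE : {V : Set} → AdjRel V → ℕ → Set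
DistIndexLE A d = ∃ λ (c : EdgeColoring A d) → IsDistinguishingEdgeColoring A d c

{-# OPTIONS --safe #-}
-- Every automorphism of M(G) maps V(G) to V(G): if an edge ab were sent to a vertex v, the
-- images of a and b would be two distinct edges through v, hence adjacent in M(G), whereas a
-- and b are not.  So an automorphism of M(G) induces an automorphism π of G, and it is the
-- identity once π is.  Fix a root r.  If π fixes r it preserves the distance layers around r,
-- hence the relation "u is a child of w" (adjacent, one layer further out), and by induction
-- over the layers π is the identity as soon as it fixes r and all children of fixed vertices.
--
-- D(M(G)) ≤ Δ: colour r with 1, the other vertices of G with 0, and the edge from w to its
-- child u with the rank of u among the children of w, which is below deg w ≤ Δ.  Connected
-- graphs of order at least 3 have Δ ≥ 2, so both vertex colours are available.
--
-- D′(M(G)) ≤ 3: colour the M(G)-edges at r with 2, the M(G)-edge between u and wu with 1 when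
-- u is the least child of w, and the M(G)-edge between wu and wu′ with 1 when u and u′ are
-- consecutive children of w.  Then the children of a fixed w are fixed one after another.
--
-- Sharpness: the reversal of the path P₃ lifts to a non-trivial automorphism of M(P₃), so one
-- colour does not suffice, while Δ(P₃) = 2.

module Submission where

open import Defs renaming (sym to adj-sym)
open import Data.Bool using (Bool; true; false; T; _∧_; _∨_; not; if_then_else_)
import Data.Bool as Bool
open import Data.Bool.Properties using (T-∧; T-∨; T-irrelevant; ∨-comm; ∨-idem)
open import Data.Empty using (⊥-elim)
open import Data.Fin using (Fin; toℕ; opposite; _<_; _>_; _<?_; _≟_)
open import Data.Fin.Patterns using (0F; 1F; 2F)
open import Data.Fin.Properties
  using (toℕ-injective; toℕ-fromℕ<; opposite-involutive; <-cmp; <-trans; <-irrefl; <⇒≢; any?; all?)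
open import Data.Fin.Induction using (<-wellFounded; >-wellFounded)
open import Induction.WellFounded using (Acc; acc)
open import Data.List using ([]; _∷_; map; allFin; foldr; upTo)
open import Data.Bool.ListAction using (any)
open import Data.List.Membership.Propositional using (_∈_; lose; find)
open import Data.List.Membership.Propositional.Properties using (∈-allFin; ∈-map⁺; ∈-upTo⁺)
open import Data.List.Relation.Unary.Any using (here; there)
open import Data.List.Relation.Unary.Any.Properties using (any⁺; any⁻)
open import Data.Nat as ℕ using (ℕ; _≤_; ∣_-_∣; zero; suc; _+_; _⊔_; z≤n; s≤s)
open import Data.Nat.ListAction using (sum)
open import Data.Nat.DivMod using (_mod_; _%_; m%n<n; m<n⇒m%n≡m)
open import Data.Nat.Properties as ℕ
  using (<ᵇ⇒<; <⇒<ᵇ; ≤-refl; ≤-trans; m≤m⊔n; m≤n⊔m; +-mono-≤; +-mono-<-≤; +-mono-≤-<)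
open import Data.Product using (Σ; ∃; _×_; _,_; proj₁; proj₂)
open import Data.Sum using (_⊎_; inj₁; inj₂)
open import Data.Sum.Properties using (inj₁-injective; inj₂-injective)
open import Data.Unit using (tt)
open import Function using (_∘_; _⇔_; mk⇔; Equivalence)
open import Relation.Binary.PropositionalEquality
  using (_≡_; _≢_; refl; sym; trans; cong; cong₂; subst; subst₂; module ≡-Reasoning)
open import Relation.Nullary using (¬_; Dec; yes; no; ¬?; _×-dec_; _→-dec_)
open import Relation.Binary.Definitions using (tri<; tri≈; tri>)
open import Relation.Nullary.Decidable using (⌊_⌋; toWitness; fromWitness; T?)

open Equivalence using (to; from)

T-injective : ∀ {a b} → (T a → T b) → (T b → T a) → a ≡ b
T-injective {false} {false} _ _ = refl
T-injective {false} {true}  _ g = ⊥-elim (g tt)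
T-injective {true}  {false} f _ = ⊥-elim (f tt)
T-injective {true}  {true}  _ _ = refl

any-intro : ∀ {A : Set} (p : A → Bool) {x xs} → x ∈ xs → T (p x) → T (any p xs)
any-intro p x∈xs px = any⁺ p (lose x∈xs px)

any-elim : ∀ {A : Set} (p : A → Bool) xs → T (any p xs) → ∃ λ x → x ∈ xs × T (p x)
any-elim p xs t = find (any⁻ p xs t)

any-cong : ∀ {A : Set} {p q : A → Bool} → (∀ x → p x ≡ q x) → ∀ xs → any p xs ≡ any q xs
any-cong p≗q []       = refl
any-cong p≗q (x ∷ xs) = cong₂ _∨_ (p≗q x) (any-cong p≗q xs)

module _ {n : ℕ} where

  anyFin : (Fin n → Bool) → Bool
  anyFin p = any p (allFin n)

  anyFin-intro : (p : Fin n → Bool) {i : Fin n} → T (p i) → T (anyFin p)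
  anyFin-intro p {i} = any-intro p (∈-allFin i)

  anyFin-elim : (p : Fin n → Bool) → T (anyFin p) → ∃ λ i → T (p i)
  anyFin-elim p t with i , _ , pi ← any-elim p (allFin n) t = i , pi

  anyFin-∘ : (p : Fin n → Bool) (f g : Fin n → Fin n) → (∀ i → f (g i) ≡ i) → anyFin (p ∘ f) ≡ anyFin p
  anyFin-∘ p f g fg = T-injective
    (λ t → let i , pfi = anyFin-elim (p ∘ f) t in anyFin-intro p pfi)
    (λ t → let i , pi = anyFin-elim p t in anyFin-intro (p ∘ f) {g i} (subst (T ∘ p) (sym (fg i)) pi))

  anyFin-cong : {p q : Fin n → Bool} → (∀ i → p i ≡ q i) → anyFin p ≡ anyFin q
  anyFin-cong p≗q = any-cong p≗q (allFin n)

  countFin : (Fin n → Bool) → ℕ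
  countFin p = sum (map (λ i → if p i then 1 else 0) (allFin n))

indicator-mono : ∀ {a b} → (T a → T b) → (if a then 1 else 0) ≤ (if b then 1 else 0)
indicator-mono {false}         _ = z≤n
indicator-mono {true}  {true}  _ = ≤-refl
indicator-mono {true}  {false} f = ⊥-elim (f tt)

indicator-< : ∀ {a b} → ¬ T a → T b → (if a then 1 else 0) ℕ.< (if b then 1 else 0)
indicator-< {false} {true} _  _ = ≤-refl
indicator-< {true}         ¬a _ = ⊥-elim (¬a tt)

sum-map-mono : ∀ {A : Set} {f g : A → ℕ} → (∀ x → f x ≤ g x) → ∀ xs → sum (map f xs) ≤ sum (map g xs)
sum-map-mono f≤g []       = z≤n
sum-map-mono f≤g (x ∷ xs) = +-mono-≤ (f≤g x) (sum-map-mono f≤g xs)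

sum-map-mono-< : ∀ {A : Set} {f g : A → ℕ} → (∀ x → f x ≤ g x) → ∀ {x xs} → x ∈ xs → f x ℕ.< g x →
                 sum (map f xs) ℕ.< sum (map g xs)
sum-map-mono-< f≤g {xs = _ ∷ xs} (here refl) fx<gx = +-mono-<-≤ fx<gx (sum-map-mono f≤g xs)
sum-map-mono-< f≤g {xs = y ∷ _}  (there x∈xs) fx<gx = +-mono-≤-< (f≤g y) (sum-map-mono-< f≤g x∈xs fx<gx)

module _ {n : ℕ} (p q : Fin n → Bool) (p⊆q : ∀ i → T (p i) → T (q i)) where

  countFin-mono : countFin p ≤ countFin q
  countFin-mono = sum-map-mono (λ i → indicator-mono (p⊆q i)) (allFin n)

  countFin-mono-< : ∀ {j} → ¬ T (p j) → T (q j) → countFin p ℕ.< countFin q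
  countFin-mono-< {j} ¬pj qj = sum-map-mono-< (λ i → indicator-mono (p⊆q i)) (∈-allFin j) (indicator-< ¬pj qj)

≤-foldr-⊔ : ∀ {m ms} → m ∈ ms → m ≤ foldr _⊔_ 0 ms
≤-foldr-⊔ {ms = _ ∷ ms} (here refl) = m≤m⊔n _ (foldr _⊔_ 0 ms)
≤-foldr-⊔ {ms = m ∷ _}  (there m∈ms) = ≤-trans (≤-foldr-⊔ m∈ms) (m≤n⊔m m _)

not-T : ∀ {a} → T (not a) → ¬ T a
not-T {false} _ ()

T-not : ∀ {a} → ¬ T a → T (not a)
T-not {false} _  = tt
T-not {true}  ¬a = ¬a tt

if-T : ∀ {A : Set} {b} {x y : A} → T b → (if b then x else y) ≡ x
if-T {b = true} _ = refl

if-¬T : ∀ {A : Set} {b} {x y : A} → ¬ T b → (if b then x else y) ≡ y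
if-¬T {b = false} _  = refl
if-¬T {b = true}  ¬b = ⊥-elim (¬b tt)

module _ {n : ℕ} where

  ==-refl : (x : Fin n) → T (x == x)
  ==-refl x = fromWitness {a? = x ≟ x} refl

  ≢⇒¬== : {x y : Fin n} → x ≢ y → ¬ T (x == y)
  ≢⇒¬== x≢y = x≢y ∘ toWitness

  ==-injective : (f : Fin n → Fin n) → (∀ {x y} → f x ≡ f y → x ≡ y) → ∀ x y → (f x == f y) ≡ (x == y)
  ==-injective f f-inj x y = T-injective (fromWitness ∘ f-inj ∘ toWitness) (fromWitness ∘ cong f ∘ toWitness)

mod-injective : ∀ {m m′ d} .{{_ : ℕ.NonZero d}} → m ℕ.< d → m′ ℕ.< d → m mod d ≡ m′ mod d → m ≡ m′
mod-injective {m} {m′} {d} m<d m′<d same = begin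
  m              ≡⟨ sym (m<n⇒m%n≡m m<d) ⟩
  m % d          ≡⟨ sym (toℕ-fromℕ< (m%n<n m d)) ⟩
  toℕ (m mod d)  ≡⟨ cong toℕ same ⟩
  toℕ (m′ mod d) ≡⟨ toℕ-fromℕ< (m%n<n m′ d) ⟩
  m′ % d         ≡⟨ m<n⇒m%n≡m m′<d ⟩
  m′             ∎
  where open ≡-Reasoning

-- Counting and ordering in Fin n

module OrderedSubset {n : ℕ} (P : Fin n → Bool) where

  rank : Fin n → ℕ
  rank u = countFin (λ x → P x ∧ ⌊ x <? u ⌋)

  below⇔ : ∀ (u x : Fin n) → T (P x ∧ ⌊ x <? u ⌋) ⇔ (T (P x) × x < u)
  below⇔ u x = mk⇔ (λ t → let px , x<u = to (T-∧ {P x}) t in px , toWitness x<u)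
                   (λ (px , x<u) → from (T-∧ {P x}) (px , fromWitness x<u))

  private
    below-⊆ : ∀ {u u′ : Fin n} → u < u′ → ∀ x → T (P x ∧ ⌊ x <? u ⌋) → T (P x ∧ ⌊ x <? u′ ⌋)
    below-⊆ {u} {u′} u<u′ x t = let px , x<u = to (below⇔ u x) t in from (below⇔ u′ x) (px , <-trans x<u u<u′)

    ∉below-self : ∀ (u : Fin n) → ¬ T (P u ∧ ⌊ u <? u ⌋)
    ∉below-self u t = <-irrefl refl (proj₂ (to (below⇔ u u) t))

  rank-<-count : ∀ {u} → T (P u) → rank u ℕ.< countFin P
  rank-<-count {u} pu = countFin-mono-< _ P (λ x → proj₁ ∘ to (below⇔ u x)) (∉below-self u) pu

  rank-strictMono : ∀ {u u′ : Fin n} → T (P u) → u < u′ → rank u ℕ.< rank u′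
  rank-strictMono {u} {u′} pu u<u′ =
    countFin-mono-< _ (λ x → P x ∧ ⌊ x <? u′ ⌋) (below-⊆ u<u′) (∉below-self u) (from (below⇔ u′ u) (pu , u<u′))

  rank-injective : ∀ {u u′} → T (P u) → T (P u′) → rank u ≡ rank u′ → u ≡ u′
  rank-injective {u} {u′} pu pu′ same with <-cmp u u′
  ... | tri< u<u′ _ _ = ⊥-elim (ℕ.<-irrefl same (rank-strictMono pu u<u′))
  ... | tri≈ _ u=u′ _ = u=u′
  ... | tri> _ _ u′<u = ⊥-elim (ℕ.<-irrefl (sym same) (rank-strictMono pu′ u′<u))

  Least : Fin n → Set
  Least u = T (P u) × (∀ x → T (P x) → ¬ x < u)

  least? : ∀ u → Dec (Least u)
  least? u = T? (P u) ×-dec all? (λ x → T? (P x) →-dec ¬? (x <? u))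

  least-unique : ∀ {u u′} → Least u → Least u′ → u ≡ u′
  least-unique {u} {u′} (pu , u-min) (pu′ , u′-min) with <-cmp u u′
  ... | tri< u<u′ _ _ = ⊥-elim (u′-min u pu u<u′)
  ... | tri≈ _ u=u′ _ = u=u′
  ... | tri> _ _ u′<u = ⊥-elim (u-min u′ pu′ u′<u)

  Consecutive : Fin n → Fin n → Set
  Consecutive p u = T (P p) × T (P u) × p < u × (∀ x → T (P x) → p < x → ¬ x < u)

  consecutive? : ∀ p u → Dec (Consecutive p u)
  consecutive? p u =
    T? (P p) ×-dec T? (P u) ×-dec (p <? u) ×-dec all? (λ x → T? (P x) →-dec (p <? x) →-dec ¬? (x <? u))

  consecutive-unique : ∀ {p u u′} → Consecutive p u → Consecutive p u′ → u ≡ u′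
  consecutive-unique {u = u} {u′} (_ , pu , p<u , gap) (_ , pu′ , p<u′ , gap′) with <-cmp u u′
  ... | tri< u<u′ _ _ = ⊥-elim (gap′ u pu p<u u<u′)
  ... | tri≈ _ u=u′ _ = u=u′
  ... | tri> _ _ u′<u = ⊥-elim (gap u′ pu′ p<u′ u′<u)

  predecessor : ∀ {u} → T (P u) → ¬ Least u → ∃ λ p → Consecutive p u
  predecessor {u} pu ¬least with any? (λ x → T? (P x) ×-dec (x <? u))
  ... | no  nothing-below      = ⊥-elim (¬least (pu , λ x px x<u → nothing-below (x , px , x<u)))
  ... | yes (x , px , x<u) = climb x (>-wellFounded x) px x<u
    where
    climb : ∀ x → Acc _>_ x → T (P x) → x < u → ∃ λ p → Consecutive p u
    climb x (acc rs) px x<u with any? (λ y → T? (P y) ×-dec (x <? y) ×-dec (y <? u))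
    ... | no  nothing-between     = x , px , pu , x<u , λ y py x<y y<u → nothing-between (y , py , x<y , y<u)
    ... | yes (y , py , x<y , y<u) = climb y (rs x<y) py y<u

-- Graphs and automorphisms

module _ {n : ℕ} (G : SimpleGraph n) where

  adj-symmetric : ∀ {x y} → T (adj G x y) → T (adj G y x)
  adj-symmetric {x} {y} = subst T (adj-sym G x y)

  adj⇒≢ : ∀ {x y} → T (adj G x y) → x ≢ y
  adj⇒≢ {x} xy refl = subst T (irrefl G x) xy

  degree≤maxDegree : ∀ v → degree G v ≤ maxDegree G
  degree≤maxDegree v = ≤-foldr-⊔ (∈-map⁺ (degree G) (∈-allFin v))

  degree≥2 : ∀ {v a b} → a ≢ b → T (adj G v a) → T (adj G v b) → 2 ≤ degree G v
  degree≥2 {v} {a} {b} a≢b va vb = ℕ.≤-<-trans (ℕ.<-≤-trans (s≤s z≤n) ∅<[a]) [a]<deg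
    where
    ∅<[a] : countFin (λ (_ : Fin n) → false) ℕ.< countFin (_== a)
    ∅<[a] = countFin-mono-< (λ (_ : Fin n) → false) (_== a) (λ _ ()) (λ ()) (==-refl a)
    [a]<deg : countFin (_== a) ℕ.< degree G v
    [a]<deg = countFin-mono-< (_== a) (adj G v) (λ x x=a → subst (T ∘ adj G v) (sym (toWitness x=a)) va)
                 (a≢b ∘ sym ∘ toWitness) vb

  walk-endpoints-adjacent : (∀ v → degree G v ≤ 1) → ∀ {x z} → Reachable G x z → x ≡ z ⊎ T (adj G x z)
  walk-endpoints-adjacent deg≤1 here = inj₁ refl
  walk-endpoints-adjacent deg≤1 (step {x} {y} {z} xy p) with walk-endpoints-adjacent deg≤1 p
  ... | inj₁ refl = inj₂ xy
  ... | inj₂ yz with x ≟ z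
  ...   | yes x=z = inj₁ x=z
  ...   | no  x≢z = ⊥-elim (ℕ.<-irrefl refl (ℕ.≤-trans (degree≥2 x≢z (adj-symmetric xy) yz) (deg≤1 y)))

  isolated⇒unique : Connected G → ∀ {r} → (∀ y → ¬ T (adj G r y)) → ∀ u → u ≡ r
  isolated⇒unique connected {r} isolated u with connected r u
  ... | here      = refl
  ... | step ry _ = ⊥-elim (isolated _ ry)

walkLength : ∀ {n} {G : SimpleGraph n} {x y} → Reachable G x y → ℕ
walkLength here       = 0
walkLength (step _ p) = suc (walkLength p)

maxDegree≥2 : ∀ {m} (G : SimpleGraph (3 + m)) → Connected G → 2 ≤ maxDegree G
maxDegree≥2 G connected with 2 ℕ.≤? maxDegree G
... | yes 2≤Δ = 2≤Δ
... | no  2≰Δ = ⊥-elim (ℕ.<-irrefl refl (ℕ.≤-trans 2≤deg[0] (deg≤1 0F)))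
  where
  deg≤1 : ∀ v → degree G v ≤ 1
  deg≤1 v = ℕ.≤-pred (ℕ.<-≤-trans (s≤s (degree≤maxDegree G v)) (ℕ.≰⇒> 2≰Δ))
  adjacent-to-0 : ∀ v → 0F ≢ v → T (adj G 0F v)
  adjacent-to-0 v 0≢v with walk-endpoints-adjacent G deg≤1 (connected 0F v)
  ... | inj₁ 0=v = ⊥-elim (0≢v 0=v)
  ... | inj₂ 0~v = 0~v
  2≤deg[0] : 2 ≤ degree G 0F
  2≤deg[0] = degree≥2 G (λ ()) (adjacent-to-0 1F (λ ())) (adjacent-to-0 2F (λ ()))

module _ {V : Set} {A : AdjRel V} where

  inverse : Automorphism A → Automorphism A
  inverse σ = record
    { fun      = inv σ
    ; inv      = fun σ
    ; inverseˡ = inverseʳ σ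
    ; inverseʳ = inverseˡ σ
    ; preserve = λ x y → trans (sym (preserve σ (inv σ x) (inv σ y))) (cong₂ A (inverseˡ σ x) (inverseˡ σ y))
    }

  fun-injective : (σ : Automorphism A) → ∀ {x y} → fun σ x ≡ fun σ y → x ≡ y
  fun-injective σ {x} {y} σx=σy = trans (sym (inverseʳ σ x)) (trans (cong (inv σ) σx=σy) (inverseʳ σ y))

  preserves-T : (σ : Automorphism A) → ∀ x y → T (A x y) → T (A (fun σ x) (fun σ y))
  preserves-T σ x y = subst T (sym (preserve σ x y))

  ¬DistNumberLE-0 : V → ¬ DistNumberLE A 0
  ¬DistNumberLE-0 x (c , _) with () ← c x

  ¬DistNumberLE-1 : (σ : Automorphism A) (x : V) → fun σ x ≢ x → ¬ DistNumberLE A 1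
  ¬DistNumberLE-1 σ x σx≢x (c , distinguishing) =
    σx≢x (distinguishing σ (λ y → Fin1-unique (c (fun σ y)) (c y)) x)
    where
    Fin1-unique : (i j : Fin 1) → i ≡ j
    Fin1-unique 0F 0F = refl

-- The middle graph and its automorphisms

module MiddleGraph {n : ℕ} (G : SimpleGraph n) where

  M : AdjRel (MVertex G)
  M = middleAdj G

  -- An edge {x, y} is stored as the pair (x , y) with x < y, so it joins x and y forward or backward.
  infix 4 _∈ₑ_
  data _∈ₑ_ (v : Fin n) : Edge G → Set where
    source : ∀ {b t} → v ∈ₑ ((v , b) , t)
    target : ∀ {a t} → v ∈ₑ ((a , v) , t)

  data Joins : Edge G → Fin n → Fin n → Set where
    forward  : ∀ {x y t} → Joins ((x , y) , t) x y
    backward : ∀ {x y t} → Joins ((x , y) , t) y x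

  edge-≡ : ∀ {p t t′} → _≡_ {A = Edge G} (p , t) (p , t′)
  edge-≡ {p} {t} {t′} = cong (p ,_) (T-irrelevant t t′)

  edge-adj : ∀ {x y} → T (adj G x y ∧ (toℕ x ℕ.<ᵇ toℕ y)) → T (adj G x y)
  edge-adj t = proj₁ (to T-∧ t)

  edge-< : ∀ {x y} → T (adj G x y ∧ (toℕ x ℕ.<ᵇ toℕ y)) → toℕ x ℕ.< toℕ y
  edge-< {x} {y} t = <ᵇ⇒< (toℕ x) (toℕ y) (proj₂ (to T-∧ t))

  joins-sym : ∀ {e x y} → Joins e x y → Joins e y x
  joins-sym forward  = backward
  joins-sym backward = forward

  joins-adj : ∀ {e x y} → Joins e x y → T (adj G x y)
  joins-adj (forward  {t = t}) = edge-adj t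
  joins-adj (backward {t = t}) = adj-symmetric G (edge-adj t)

  joins-≢ : ∀ {e x y} → Joins e x y → x ≢ y
  joins-≢ e = adj⇒≢ G (joins-adj e)

  joins-unique : ∀ {e e′ x y} → Joins e x y → Joins e′ x y → e ≡ e′
  joins-unique forward  forward  = edge-≡
  joins-unique backward backward = edge-≡
  joins-unique (forward {t = t}) (backward {t = t′}) = ⊥-elim (ℕ.<-asym (edge-< t) (edge-< t′))
  joins-unique (backward {t = t}) (forward {t = t′}) = ⊥-elim (ℕ.<-asym (edge-< t) (edge-< t′))

  edgeBetween : ∀ {x y} → T (adj G x y) → Σ (Edge G) λ e → Joins e x y
  edgeBetween {x} {y} xy with ℕ.<-cmp (toℕ x) (toℕ y)
  ... | tri< x<y _ _ = ((x , y) , from T-∧ (xy , <⇒<ᵇ x<y)) , forward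
  ... | tri≈ _ x=y _ = ⊥-elim (adj⇒≢ G xy (toℕ-injective x=y))
  ... | tri> _ _ y<x = ((y , x) , from T-∧ (adj-symmetric G xy , <⇒<ᵇ y<x)) , backward

  joins-∈ₑ : ∀ {e x y} → Joins e x y → x ∈ₑ e × y ∈ₑ e
  joins-∈ₑ forward  = source , target
  joins-∈ₑ backward = target , source

  ∈ₑ-joins : ∀ {e x y v} → Joins e x y → v ∈ₑ e → v ≡ x ⊎ v ≡ y
  ∈ₑ-joins forward  source = inj₁ refl
  ∈ₑ-joins forward  target = inj₂ refl
  ∈ₑ-joins backward source = inj₂ refl
  ∈ₑ-joins backward target = inj₁ refl

  other-endpoint-unique : ∀ {e w u u′} → Joins e w u → Joins e w u′ → u ≡ u′
  other-endpoint-unique j j′ with ∈ₑ-joins j (proj₂ (joins-∈ₑ j′))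
  ... | inj₁ u′=w = ⊥-elim (joins-≢ j′ (sym u′=w))
  ... | inj₂ u′=u = sym u′=u

  members-joins : ∀ {e x y} → x ∈ₑ e → y ∈ₑ e → x ≢ y → Joins e x y
  members-joins source source x≢y = ⊥-elim (x≢y refl)
  members-joins source target _   = forward
  members-joins target source _   = backward
  members-joins target target x≢y = ⊥-elim (x≢y refl)

  incident⇔ : ∀ v e → T (M (inj₁ v) (inj₂ e)) ⇔ v ∈ₑ e
  incident⇔ v ((a , b) , t) = mk⇔ ⇒ ⇐
    where
    ⇒ : T ((v == a) ∨ (v == b)) → v ∈ₑ ((a , b) , t)
    ⇒ v~e with v ≟ a | v ≟ b
    ... | yes refl | _        = source
    ... | no _     | yes refl = target

    ⇐ : v ∈ₑ ((a , b) , t) → T ((v == a) ∨ (v == b))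
    ⇐ v∈e with v ≟ a | v ≟ b
    ... | yes _ | _     = tt
    ... | no _  | yes _ = tt
    ... | no v≢a | no v≢b with v∈e
    ...   | source = v≢a refl
    ...   | target = v≢b refl

  adjacentEdges⇔ : ∀ e e′ → T (M (inj₂ e) (inj₂ e′)) ⇔ (e ≢ e′ × ∃ λ v → v ∈ₑ e × v ∈ₑ e′)
  adjacentEdges⇔ e@((a , b) , t) e′@((a′ , b′) , t′) = mk⇔ ⇒ ⇐
    where
    Same Meet : Bool
    Same = (a == a′) ∧ (b == b′)
    Meet = (a == a′) ∨ (a == b′) ∨ (b == a′) ∨ (b == b′)

    same⇒≡ : T Same → e ≡ e′
    same⇒≡ s with a ≟ a′ | b ≟ b′
    ... | yes refl | yes refl = edge-≡

    ≡⇒same : e ≡ e′ → T Same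
    ≡⇒same refl = from (T-∧ {a == a} {b == b}) (==-refl a , ==-refl b)

    meet⇒common : T Meet → ∃ λ v → v ∈ₑ e × v ∈ₑ e′
    meet⇒common m with a ≟ a′ | a ≟ b′ | b ≟ a′ | b ≟ b′
    ... | yes refl | _        | _        | _        = a , source , source
    ... | no _     | yes refl | _        | _        = a , source , target
    ... | no _     | no _     | yes refl | _        = b , target , source
    ... | no _     | no _     | no _     | yes refl = b , target , target

    common⇒meet : ∀ {v} → v ∈ₑ e → v ∈ₑ e′ → T Meet
    common⇒meet v∈e v∈e′ with a ≟ a′ | a ≟ b′ | b ≟ a′ | b ≟ b′
    ... | yes _ | _     | _     | _     = tt
    ... | no _  | yes _ | _     | _     = tt
    ... | no _  | no _  | yes _ | _     = tt
    ... | no _  | no _  | no _  | yes _ = tt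
    ... | no a≢a′ | no a≢b′ | no b≢a′ | no b≢b′ with v∈e | v∈e′
    ...   | source | source = a≢a′ refl
    ...   | source | target = a≢b′ refl
    ...   | target | source = b≢a′ refl
    ...   | target | target = b≢b′ refl

    ⇒ : T (not Same ∧ Meet) → e ≢ e′ × ∃ λ v → v ∈ₑ e × v ∈ₑ e′
    ⇒ t = let ¬same , meet = to T-∧ t in not-T ¬same ∘ ≡⇒same , meet⇒common meet

    ⇐ : e ≢ e′ × (∃ λ v → v ∈ₑ e × v ∈ₑ e′) → T (not Same ∧ Meet)
    ⇐ (e≢e′ , _ , v∈e , v∈e′) = from T-∧ (T-not (e≢e′ ∘ same⇒≡) , common⇒meet v∈e v∈e′)

  incident′⇔ : ∀ v e → T (M (inj₂ e) (inj₁ v)) ⇔ v ∈ₑ e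
  incident′⇔ v e@((_ , _) , _) = incident⇔ v e

module MiddleAutomorphism {n : ℕ} (G : SimpleGraph n) where
  open MiddleGraph G

  neighbour-of-vertex : ∀ z v → T (M z (inj₁ v)) → ∃ λ e → z ≡ inj₂ e × v ∈ₑ e
  neighbour-of-vertex (inj₂ e) v t = e , refl , to (incident′⇔ v e) t

  edge↛vertex : (σ : Automorphism M) → ∀ e v → fun σ (inj₂ e) ≢ inj₁ v
  edge↛vertex σ e@((a , b) , t) v σe=v = subst T (preserve σ (inj₁ a) (inj₁ b)) σa~σb
    where
    end-image : ∀ {x} → x ∈ₑ e → ∃ λ e′ → fun σ (inj₁ x) ≡ inj₂ e′ × v ∈ₑ e′
    end-image {x} x∈e = neighbour-of-vertex (fun σ (inj₁ x)) v
      (subst (T ∘ M (fun σ (inj₁ x))) σe=v (preserves-T σ (inj₁ x) (inj₂ e) (from (incident⇔ x e) x∈e)))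
    σa≢σb : fun σ (inj₁ a) ≢ fun σ (inj₁ b)
    σa≢σb = adj⇒≢ G (edge-adj t) ∘ inj₁-injective ∘ fun-injective σ
    σa~σb : T (M (fun σ (inj₁ a)) (fun σ (inj₁ b)))
    σa~σb with ea , σa=ea , v∈ea ← end-image source | eb , σb=eb , v∈eb ← end-image target =
      subst T (sym (cong₂ M σa=ea σb=eb)) (from (adjacentEdges⇔ ea eb)
        ((λ ea=eb → σa≢σb (trans σa=ea (trans (cong inj₂ ea=eb) (sym σb=eb)))) , v , v∈ea , v∈eb))

  vertex↛edge : (σ : Automorphism M) → ∀ v e → fun σ (inj₁ v) ≢ inj₂ e
  vertex↛edge σ v e σv=e = edge↛vertex (inverse σ) e v (trans (cong (inv σ) (sym σv=e)) (inverseʳ σ (inj₁ v)))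

  module Induced (σ : Automorphism M) where

    vertexImage : ∀ v → ∃ λ w → fun σ (inj₁ v) ≡ inj₁ w
    vertexImage v with fun σ (inj₁ v) in σv
    ... | inj₁ w = w , refl
    ... | inj₂ e = ⊥-elim (vertex↛edge σ v e σv)

    edgeImage : ∀ e → ∃ λ e′ → fun σ (inj₂ e) ≡ inj₂ e′
    edgeImage e with fun σ (inj₂ e) in σe
    ... | inj₁ v  = ⊥-elim (edge↛vertex σ e v σe)
    ... | inj₂ e′ = e′ , refl

    π : Fin n → Fin n
    π v = proj₁ (vertexImage v)

    π-spec : ∀ v → fun σ (inj₁ v) ≡ inj₁ (π v)
    π-spec v = proj₂ (vertexImage v)

    σₑ : Edge G → Edge G
    σₑ e = proj₁ (edgeImage e)

    σₑ-spec : ∀ e → fun σ (inj₂ e) ≡ inj₂ (σₑ e)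
    σₑ-spec e = proj₂ (edgeImage e)

    π-injective : ∀ {x y} → π x ≡ π y → x ≡ y
    π-injective {x} {y} πx=πy =
      inj₁-injective (fun-injective σ (trans (π-spec x) (trans (cong inj₁ πx=πy) (sym (π-spec y)))))

    π-∈ₑ : ∀ {v e} → v ∈ₑ e → π v ∈ₑ σₑ e
    π-∈ₑ {v} {e} v∈e = to (incident⇔ (π v) (σₑ e))
      (subst T (cong₂ M (π-spec v) (σₑ-spec e)) (preserves-T σ (inj₁ v) (inj₂ e) (from (incident⇔ v e) v∈e)))

    σₑ-joins : ∀ {e x y} → Joins e x y → Joins (σₑ e) (π x) (π y)
    σₑ-joins j with x∈e , y∈e ← joins-∈ₑ j = members-joins (π-∈ₑ x∈e) (π-∈ₑ y∈e) (joins-≢ j ∘ π-injective)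

    π-adj : ∀ {x y} → T (adj G x y) → T (adj G (π x) (π y))
    π-adj xy = joins-adj (σₑ-joins (proj₂ (edgeBetween xy)))

  open Induced public

  π-inverseʳ : (σ : Automorphism M) → ∀ v → π (inverse σ) (π σ v) ≡ v
  π-inverseʳ σ v = inj₁-injective (begin
    inj₁ (π (inverse σ) (π σ v)) ≡⟨ sym (π-spec (inverse σ) (π σ v)) ⟩
    inv σ (inj₁ (π σ v))         ≡⟨ cong (inv σ) (sym (π-spec σ v)) ⟩
    inv σ (fun σ (inj₁ v))       ≡⟨ inverseʳ σ (inj₁ v) ⟩
    inj₁ v                       ∎)
    where open ≡-Reasoning

  π-inverseˡ : (σ : Automorphism M) → ∀ v → π σ (π (inverse σ) v) ≡ v
  π-inverseˡ σ v = inj₁-injective (begin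
    inj₁ (π σ (π (inverse σ) v))   ≡⟨ sym (π-spec σ (π (inverse σ) v)) ⟩
    fun σ (inj₁ (π (inverse σ) v)) ≡⟨ cong (fun σ) (sym (π-spec (inverse σ) v)) ⟩
    fun σ (inv σ (inj₁ v))         ≡⟨ inverseˡ σ (inj₁ v) ⟩
    inj₁ v                         ∎)
    where open ≡-Reasoning

  induced : Automorphism M → Automorphism (adj G)
  induced σ = record
    { fun      = π σ
    ; inv      = π (inverse σ)
    ; inverseˡ = π-inverseˡ σ
    ; inverseʳ = π-inverseʳ σ
    ; preserve = λ x y → T-injective (reflect x y) (π-adj σ)
    }
    where
    reflect : ∀ x y → T (adj G (π σ x) (π σ y)) → T (adj G x y)
    reflect x y = subst₂ (λ x y → T (adj G x y)) (π-inverseʳ σ x) (π-inverseʳ σ y) ∘ π-adj (inverse σ)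

  identity-if-vertices-fixed : (σ : Automorphism M) → (∀ v → π σ v ≡ v) → IsIdentity σ
  identity-if-vertices-fixed σ πv=v (inj₁ v) = trans (π-spec σ v) (cong inj₁ (πv=v v))
  identity-if-vertices-fixed σ πv=v (inj₂ e@((a , b) , _)) =
    trans (σₑ-spec σ e) (cong inj₂ (joins-unique σe-joins forward))
    where
    σe-joins : Joins (σₑ σ e) a b
    σe-joins = subst₂ (Joins (σₑ σ e)) (πv=v a) (πv=v b) (σₑ-joins σ forward)

  module Lift (π : Automorphism (adj G)) where

    liftEdge : Edge G → Edge G
    liftEdge ((a , b) , t) = proj₁ (edgeBetween (preserves-T π a b (edge-adj t)))

    liftEdge-joins : ∀ {e x y} → Joins e x y → Joins (liftEdge e) (fun π x) (fun π y)
    liftEdge-joins forward  = proj₂ (edgeBetween _)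
    liftEdge-joins backward = joins-sym (proj₂ (edgeBetween _))

    lift-∈ₑ : ∀ {v e} → v ∈ₑ e → fun π v ∈ₑ liftEdge e
    lift-∈ₑ source = proj₁ (joins-∈ₑ (liftEdge-joins forward))
    lift-∈ₑ target = proj₂ (joins-∈ₑ (liftEdge-joins forward))

    liftFun : MVertex G → MVertex G
    liftFun (inj₁ v) = inj₁ (fun π v)
    liftFun (inj₂ e) = inj₂ (liftEdge e)

  open Lift

  lift-cancel : (π π′ : Automorphism (adj G)) → (∀ v → fun π (fun π′ v) ≡ v) →
                ∀ x → liftFun π (liftFun π′ x) ≡ x
  lift-cancel π π′ ππ′ (inj₁ v)               = cong inj₁ (ππ′ v)
  lift-cancel π π′ ππ′ (inj₂ e@((a , b) , _)) = cong inj₂ (joins-unique ππ′e-joins forward)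
    where
    ππ′e-joins : Joins (liftEdge π (liftEdge π′ e)) a b
    ππ′e-joins = subst₂ (Joins _) (ππ′ a) (ππ′ b) (liftEdge-joins π (liftEdge-joins π′ forward))

  lift-adj : (π : Automorphism (adj G)) → ∀ x y → T (M x y) → T (M (liftFun π x) (liftFun π y))
  lift-adj π (inj₁ v) (inj₂ e) v~e =
    from (incident⇔ (fun π v) (liftEdge π e)) (lift-∈ₑ π (to (incident⇔ v e) v~e))
  lift-adj π (inj₂ e) (inj₁ v) e~v =
    from (incident′⇔ (fun π v) (liftEdge π e)) (lift-∈ₑ π (to (incident′⇔ v e) e~v))
  lift-adj π (inj₂ e) (inj₂ e′) ee with e≢e′ , v , v∈e , v∈e′ ← to (adjacentEdges⇔ e e′) ee =
    from (adjacentEdges⇔ (liftEdge π e) (liftEdge π e′))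
      (πe≢πe′ , fun π v , lift-∈ₑ π v∈e , lift-∈ₑ π v∈e′)
    where
    πe≢πe′ : liftEdge π e ≢ liftEdge π e′
    πe≢πe′ πe=πe′ = e≢e′ (inj₂-injective (begin
      inj₂ e                                      ≡⟨ sym (lift-cancel (inverse π) π (inverseʳ π) (inj₂ e)) ⟩
      inj₂ (liftEdge (inverse π) (liftEdge π e))  ≡⟨ cong (inj₂ ∘ liftEdge (inverse π)) πe=πe′ ⟩
      inj₂ (liftEdge (inverse π) (liftEdge π e′)) ≡⟨ lift-cancel (inverse π) π (inverseʳ π) (inj₂ e′) ⟩
      inj₂ e′                                     ∎))
      where open ≡-Reasoning

  lift : Automorphism (adj G) → Automorphism M
  lift π = record
    { fun      = liftFun π
    ; inv      = liftFun (inverse π)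
    ; inverseˡ = lift-cancel π (inverse π) (inverseˡ π)
    ; inverseʳ = lift-cancel (inverse π) π (inverseʳ π)
    ; preserve = λ x y → T-injective (reflect x y) (lift-adj π x y)
    }
    where
    cancel : ∀ x → liftFun (inverse π) (liftFun π x) ≡ x
    cancel = lift-cancel (inverse π) π (inverseʳ π)
    reflect : ∀ x y → T (M (liftFun π x) (liftFun π y)) → T (M x y)
    reflect x y =
      subst₂ (λ x y → T (M x y)) (cancel x) (cancel y) ∘ lift-adj (inverse π) (liftFun π x) (liftFun π y)

-- Distance layers around a root

module Layers {n : ℕ} (G : SimpleGraph n) (r : Fin n) where

  within : ℕ → Fin n → Bool
  within zero    u = u == r
  within (suc k) u = within k u ∨ anyFin (λ w → adj G u w ∧ within k w)

  within-suc : ∀ k {u} → T (within k u) → T (within (suc k) u)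
  within-suc k u∈ = from T-∨ (inj₁ u∈)

  within-step : ∀ k {u w} → T (adj G u w) → T (within k w) → T (within (suc k) u)
  within-step k {u} uw w∈ =
    from (T-∨ {within k u}) (inj₂ (anyFin-intro (λ w → adj G u w ∧ within k w) (from T-∧ (uw , w∈))))

  within-mono : ∀ {k k′} u → k ≤ k′ → T (within k u) → T (within k′ u)
  within-mono {k} {k′} u k≤k′ u∈ with ℕ.m≤n⇒m<n∨m≡n k≤k′
  ... | inj₂ refl = u∈
  ... | inj₁ k<k′ with suc k″ ← k′ = within-suc k″ (within-mono u (ℕ.≤-pred k<k′) u∈)

  within-walk : ∀ {u} (p : Reachable G u r) → T (within (walkLength p) u)
  within-walk here        = ==-refl r
  within-walk (step uw p) = within-step (walkLength p) uw (within-walk p)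

  all-within : Connected G → ∃ λ N → ∀ u → T (within N u)
  all-within connected =
    N , λ u → within-mono u (≤-foldr-⊔ (∈-map⁺ length (∈-allFin u))) (within-walk (connected u r))
    where
    length : Fin n → ℕ
    length u = walkLength (connected u r)
    N : ℕ
    N = foldr _⊔_ 0 (map length (allFin n))

  module _ (π : Automorphism (adj G)) (πr=r : fun π r ≡ r) where

    within-automorphism : ∀ k u → within k (fun π u) ≡ within k u
    within-automorphism zero u = begin
      (fun π u == r)       ≡⟨ cong (fun π u ==_) (sym πr=r) ⟩
      (fun π u == fun π r) ≡⟨ ==-injective (fun π) (fun-injective π) u r ⟩
      (u == r)             ∎
      where open ≡-Reasoning
    within-automorphism (suc k) u = begin
      within k (fun π u) ∨ anyFin (λ w → adj G (fun π u) w ∧ within k w)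
        ≡⟨ cong₂ _∨_ (within-automorphism k u) (sym (anyFin-∘ _ (fun π) (inv π) (inverseˡ π))) ⟩
      within k u ∨ anyFin (λ w → adj G (fun π u) (fun π w) ∧ within k (fun π w))
        ≡⟨ cong (within k u ∨_) (anyFin-cong (λ w → cong₂ _∧_ (preserve π u w) (within-automorphism k w))) ⟩
      within k u ∨ anyFin (λ w → adj G u w ∧ within k w)
        ∎
      where open ≡-Reasoning

  -- N has to bound the distances to r (see all-within) for child to be the parent–child relation.
  module Children (N : ℕ) where

    child : Fin n → Fin n → Bool
    child w u = adj G w u ∧ any (λ k → within k w ∧ not (within k u)) (upTo N)

    child-intro : ∀ {w u} k → k ℕ.< N → T (adj G w u) → T (within k w) → ¬ T (within k u) → T (child w u)
    child-intro {w} {u} k k<N wu w∈ u∉ =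
      from T-∧ (wu , any-intro (λ k → within k w ∧ not (within k u)) (∈-upTo⁺ k<N) (from T-∧ (w∈ , T-not u∉)))

    child-adj : ∀ {w u} → T (child w u) → T (adj G w u)
    child-adj c = proj₁ (to T-∧ c)

    child-separated : ∀ {w u} → T (child w u) → ∃ λ k → T (within k w) × ¬ T (within k u)
    child-separated {w} {u} c
      with k , _ , sep ← any-elim (λ k → within k w ∧ not (within k u)) (upTo N) (proj₂ (to T-∧ c)) =
      k , proj₁ (to T-∧ sep) , not-T (proj₂ (to T-∧ sep))

    child-asym : ∀ {w u} → T (child w u) → ¬ T (child u w)
    child-asym wu uw with k , w∈ , u∉ ← child-separated wu | k′ , u∈ , w∉ ← child-separated uw
                     with ℕ.≤-total k k′
    ... | inj₁ k≤k′ = w∉ (within-mono _ k≤k′ w∈)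
    ... | inj₂ k′≤k = u∉ (within-mono _ k′≤k u∈)

    child-≢-root : ∀ {w u} → T (child w u) → u ≢ r
    child-≢-root c refl with k , _ , r∉ ← child-separated c = r∉ (within-mono {0} {k} r z≤n (==-refl r))

    child-automorphism : (π : Automorphism (adj G)) → fun π r ≡ r →
                         ∀ w u → child (fun π w) (fun π u) ≡ child w u
    child-automorphism π πr=r w u = cong₂ _∧_ (preserve π w u) (any-cong separates (upTo N))
      where
      separates : ∀ k → (within k (fun π w) ∧ not (within k (fun π u))) ≡ (within k w ∧ not (within k u))
      separates k = cong₂ (λ a b → a ∧ not b) (within-automorphism π πr=r k w) (within-automorphism π πr=r k u)

    child-image : (π : Automorphism (adj G)) → fun π r ≡ r →
                  ∀ {w u} → fun π w ≡ w → T (child w u) → T (child w (fun π u))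
    child-image π πr=r {w} {u} πw=w wu =
      subst (λ z → T (child z (fun π u))) πw=w (subst T (sym (child-automorphism π πr=r w u)) wu)

    fixed-if-children-fixed : (π : Automorphism (adj G)) → fun π r ≡ r → (∀ u → T (within N u)) →
                              (∀ w u → fun π w ≡ w → T (child w u) → fun π u ≡ u) → ∀ u → fun π u ≡ u
    fixed-if-children-fixed π πr=r all∈ children-fixed u = layer-fixed N ≤-refl u (all∈ u)
      where
      layer-fixed : ∀ k → k ≤ N → ∀ u → T (within k u) → fun π u ≡ u
      layer-fixed zero    _    u u∈ with refl ← toWitness u∈ = πr=r
      layer-fixed (suc k) k<N u u∈ with T? (within k u)
      ... | yes u∈k = layer-fixed k (ℕ.<⇒≤ k<N) u u∈k
      ... | no u∉k with to T-∨ u∈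
      ...   | inj₁ u∈k = ⊥-elim (u∉k u∈k)
      ...   | inj₂ ∃w with w , uw∧w∈k ← anyFin-elim _ ∃w with uw , w∈k ← to T-∧ uw∧w∈k =
        children-fixed w u (layer-fixed k (ℕ.<⇒≤ k<N) w w∈k) (child-intro k k<N (adj-symmetric G uw) w∈k u∉k)

-- The colourings

bit : ∀ {d} → Bool → Fin (suc (suc d))
bit b = if b then 1F else 0F

bit≡1F : ∀ {d} b → bit {d} b ≡ 1F → T b
bit≡1F true _ = tt

bit-injective : ∀ {d a b} → bit {d} a ≡ bit b → a ≡ b
bit-injective {a = false} {false} _ = refl
bit-injective {a = true}  {true}  _ = refl

bit≢2F : ∀ b → bit {1} b ≢ 2F
bit≢2F false ()
bit≢2F true  ()

module VertexColouring {n : ℕ} (G : SimpleGraph n) (r : Fin n) (N : ℕ) (d : ℕ) where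
  open MiddleGraph G
  open MiddleAutomorphism G
  open Layers G r
  open Children N

  rank : Fin n → Fin n → ℕ
  rank w = OrderedSubset.rank (child w)

  -- The reduction mod 2 + d only lands the rank in Fin (2 + d): ranks are below Δ ≤ 2 + d.
  colouring : MVertex G → Fin (2 + d)
  colouring (inj₁ v)             = bit (v == r)
  colouring (inj₂ ((a , b) , _)) =
    if child a b then rank a b mod (2 + d) else if child b a then rank b a mod (2 + d) else 0F

  colouring-child-edge : ∀ {e w u} → Joins e w u → T (child w u) →
                         colouring (inj₂ e) ≡ rank w u mod (2 + d)
  colouring-child-edge forward  wu = if-T wu
  colouring-child-edge backward wu = trans (if-¬T (child-asym wu)) (if-T wu)

  rank<2+d : maxDegree G ≤ 2 + d → ∀ {w u} → T (child w u) → rank w u ℕ.< 2 + d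
  rank<2+d Δ≤2+d {w} wu = ℕ.<-≤-trans (OrderedSubset.rank-<-count (child w) wu)
    (≤-trans (countFin-mono (child w) (adj G w) (λ _ → child-adj)) (≤-trans (degree≤maxDegree G w) Δ≤2+d))

  module _ (Δ≤2+d : maxDegree G ≤ 2 + d) (all-within-N : ∀ u → T (within N u))
           (σ : Automorphism M) (σ-preserves : ∀ x → colouring (fun σ x) ≡ colouring x) where

    root-fixed : π σ r ≡ r
    root-fixed = toWitness (bit≡1F (π σ r == r) (begin
      colouring (inj₁ (π σ r))   ≡⟨ cong colouring (sym (π-spec σ r)) ⟩
      colouring (fun σ (inj₁ r)) ≡⟨ σ-preserves (inj₁ r) ⟩
      bit (r == r)               ≡⟨ if-T (==-refl r) ⟩
      1F                         ∎))
      where open ≡-Reasoning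

    children-fixed : ∀ w u → π σ w ≡ w → T (child w u) → π σ u ≡ u
    children-fixed w u πw=w wu =
      OrderedSubset.rank-injective (child w) wπu wu
        (mod-injective (rank<2+d Δ≤2+d wπu) (rank<2+d Δ≤2+d wu) same-colour)
      where
      open ≡-Reasoning
      e : Edge G
      e = proj₁ (edgeBetween (child-adj wu))
      e-joins : Joins e w u
      e-joins = proj₂ (edgeBetween (child-adj wu))
      σe-joins : Joins (σₑ σ e) w (π σ u)
      σe-joins = subst (λ z → Joins (σₑ σ e) z (π σ u)) πw=w (σₑ-joins σ e-joins)
      wπu : T (child w (π σ u))
      wπu = child-image (induced σ) root-fixed πw=w wu
      same-colour : rank w (π σ u) mod (2 + d) ≡ rank w u mod (2 + d)
      same-colour = begin
        rank w (π σ u) mod (2 + d) ≡⟨ sym (colouring-child-edge σe-joins wπu) ⟩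
        colouring (inj₂ (σₑ σ e))  ≡⟨ cong colouring (sym (σₑ-spec σ e)) ⟩
        colouring (fun σ (inj₂ e)) ≡⟨ σ-preserves (inj₂ e) ⟩
        colouring (inj₂ e)         ≡⟨ colouring-child-edge e-joins wu ⟩
        rank w u mod (2 + d)       ∎

    σ-identity : IsIdentity σ
    σ-identity =
      identity-if-vertices-fixed σ (fixed-if-children-fixed (induced σ) root-fixed all-within-N children-fixed)

middleGraph-distinguishingNumber : ∀ {n} (G : SimpleGraph n) → Connected G → Fin n →
                                   ∀ d → maxDegree G ≤ 2 + d → DistNumberLE (middleAdj G) (2 + d)
middleGraph-distinguishingNumber G connected r d Δ≤2+d
  with N , all-within-N ← Layers.all-within G r connected =
  colouring , σ-identity Δ≤2+d all-within-N
  where open VertexColouring G r N d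

middleGraph-distinguishingNumber≤Δ : ∀ {n} (G : SimpleGraph n) → 3 ≤ n → Connected G →
                                    DistNumberLE (middleAdj G) (maxDegree G)
middleGraph-distinguishingNumber≤Δ {1} _ (s≤s ())
middleGraph-distinguishingNumber≤Δ {2} _ (s≤s (s≤s ()))
middleGraph-distinguishingNumber≤Δ {suc (suc (suc _))} G _ connected
  with d , 2+d=Δ ← ℕ.m≤n⇒∃[o]m+o≡n (maxDegree≥2 G connected) =
  subst (DistNumberLE (middleAdj G)) 2+d=Δ
    (middleGraph-distinguishingNumber G connected 0F d (ℕ.≤-reflexive (sym 2+d=Δ)))

module EdgeColouring {n : ℕ} (G : SimpleGraph n) (r : Fin n) (N : ℕ) where
  open MiddleGraph G
  open MiddleAutomorphism G
  open Layers G r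
  open Children N
  open OrderedSubset
    using (Least; least?; least-unique; Consecutive; consecutive?; consecutive-unique; predecessor)

  siblings : Fin n → Fin n → Fin n → Bool
  siblings w u u′ = ⌊ consecutive? (child w) u u′ ⌋ ∨ ⌊ consecutive? (child w) u′ u ⌋

  incidenceColour : Fin n → Fin n → Fin 3
  incidenceColour x y = if x == r then 2F else bit ⌊ least? (child y) x ⌋

  incidence : Fin n → Edge G → Fin 3
  incidence x ((a , b) , _) = if x == a then incidenceColour a b else incidenceColour b a

  -- The first successful test finds the common endpoint of two adjacent edges.
  linked : Edge G → Edge G → Bool
  linked ((a , b) , _) ((a′ , b′) , _) =
    if      a == a′ then siblings a b b′
    else if a == b′ then siblings a b a′
    else if b == a′ then siblings b a b′
    else                 siblings b a a′

  colour : MVertex G → MVertex G → Fin 3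
  colour (inj₁ _) (inj₁ _)  = 0F
  colour (inj₁ x) (inj₂ e)  = incidence x e
  colour (inj₂ e) (inj₁ x)  = incidence x e
  colour (inj₂ e) (inj₂ e′) = bit (linked e e′ ∨ linked e′ e)

  colouring : EdgeColoring M 3
  colouring = record { col = colour ; colSym = colour-sym }
    where
    colour-sym : ∀ x y → colour x y ≡ colour y x
    colour-sym (inj₁ _) (inj₁ _)  = refl
    colour-sym (inj₁ _) (inj₂ _)  = refl
    colour-sym (inj₂ _) (inj₁ _)  = refl
    colour-sym (inj₂ e) (inj₂ e′) = cong bit (∨-comm (linked e e′) (linked e′ e))

  incidence-joins : ∀ {e x y} → Joins e x y → incidence x e ≡ incidenceColour x y
  incidence-joins {x = x} forward = if-T (==-refl x)
  incidence-joins j@backward      = if-¬T (≢⇒¬== (joins-≢ j))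

  linked-joins : ∀ {e e′ w u u′} → Joins e w u → Joins e′ w u′ → u ≢ u′ →
                 linked e e′ ≡ siblings w u u′
  linked-joins {w = w} forward forward _ = if-T (==-refl w)
  linked-joins {w = w} forward j′@backward _ =
    trans (if-¬T (≢⇒¬== (joins-≢ j′))) (if-T (==-refl w))
  linked-joins {w = w} j@backward forward u≢u′ =
    trans (if-¬T (≢⇒¬== (joins-≢ j ∘ sym))) (trans (if-¬T (≢⇒¬== u≢u′)) (if-T (==-refl w)))
  linked-joins j@backward j′@backward u≢u′ =
    trans (if-¬T (≢⇒¬== u≢u′)) (trans (if-¬T (≢⇒¬== (joins-≢ j ∘ sym))) (if-¬T (≢⇒¬== (joins-≢ j′))))

  colour-linked : ∀ {e e′ w u u′} → Joins e w u → Joins e′ w u′ → u ≢ u′ →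
                  colour (inj₂ e) (inj₂ e′) ≡ bit (siblings w u u′)
  colour-linked {e} {e′} {w} {u} {u′} j j′ u≢u′ = cong bit (begin
    linked e e′ ∨ linked e′ e
      ≡⟨ cong₂ _∨_ (linked-joins j j′ u≢u′) (linked-joins j′ j (u≢u′ ∘ sym)) ⟩
    siblings w u u′ ∨ siblings w u′ u
      ≡⟨ cong (siblings w u u′ ∨_) (∨-comm ⌊ consecutive? (child w) u′ u ⌋ _) ⟩
    siblings w u u′ ∨ siblings w u u′
      ≡⟨ ∨-idem (siblings w u u′) ⟩
    siblings w u u′
      ∎)
    where open ≡-Reasoning

  module _ (connected : Connected G) (all-within-N : ∀ u → T (within N u)) (σ : Automorphism M)
           (σ-preserves : ∀ x y → T (M x y) → colour (fun σ x) (fun σ y) ≡ colour x y) where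
    open ≡-Reasoning

    incidence-preserved : ∀ {e x y} → Joins e x y → incidenceColour (π σ x) (π σ y) ≡ incidenceColour x y
    incidence-preserved {e} {x} {y} j = begin
      incidenceColour (π σ x) (π σ y)          ≡⟨ sym (incidence-joins (σₑ-joins σ j)) ⟩
      colour (inj₁ (π σ x)) (inj₂ (σₑ σ e))    ≡⟨ sym (cong₂ colour (π-spec σ x) (σₑ-spec σ e)) ⟩
      colour (fun σ (inj₁ x)) (fun σ (inj₂ e)) ≡⟨ σ-preserves (inj₁ x) (inj₂ e) x~e ⟩
      colour (inj₁ x) (inj₂ e)                 ≡⟨ incidence-joins j ⟩
      incidenceColour x y                      ∎
      where
      x~e : T (M (inj₁ x) (inj₂ e))
      x~e = from (incident⇔ x e) (proj₁ (joins-∈ₑ j))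

    siblings-preserved : ∀ {e e′ w u u′} → Joins e w u → Joins e′ w u′ → u ≢ u′ →
                         siblings (π σ w) (π σ u) (π σ u′) ≡ siblings w u u′
    siblings-preserved {e} {e′} {w} {u} {u′} j j′ u≢u′ = bit-injective {1} (begin
      bit (siblings (π σ w) (π σ u) (π σ u′))
        ≡⟨ sym (colour-linked (σₑ-joins σ j) (σₑ-joins σ j′) (u≢u′ ∘ π-injective σ)) ⟩
      colour (inj₂ (σₑ σ e)) (inj₂ (σₑ σ e′))   ≡⟨ sym (cong₂ colour (σₑ-spec σ e) (σₑ-spec σ e′)) ⟩
      colour (fun σ (inj₂ e)) (fun σ (inj₂ e′)) ≡⟨ σ-preserves (inj₂ e) (inj₂ e′) e~e′ ⟩
      colour (inj₂ e) (inj₂ e′)                 ≡⟨ colour-linked j j′ u≢u′ ⟩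
      bit (siblings w u u′)                     ∎)
      where
      e~e′ : T (M (inj₂ e) (inj₂ e′))
      e~e′ = from (adjacentEdges⇔ e e′)
        ((λ { refl → u≢u′ (other-endpoint-unique j j′) }) , w , proj₁ (joins-∈ₑ j) , proj₁ (joins-∈ₑ j′))

    root-fixed : π σ r ≡ r
    root-fixed with any? (λ y → T? (adj G r y))
    ... | no isolated = isolated⇒unique G connected (λ y ry → isolated (y , ry)) (π σ r)
    ... | yes (y , ry) with π σ r ≟ r
    ...   | yes πr=r = πr=r
    ...   | no  πr≢r = ⊥-elim (bit≢2F _ (begin
      bit _                           ≡⟨ sym (if-¬T (≢⇒¬== πr≢r)) ⟩
      incidenceColour (π σ r) (π σ y) ≡⟨ incidence-preserved (proj₂ (edgeBetween ry)) ⟩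
      incidenceColour r y             ≡⟨ if-T (==-refl r) ⟩
      2F                              ∎))

    module _ {w} (πw=w : π σ w ≡ w) where

      least-child-fixed : ∀ {u} → Least (child w) u → π σ u ≡ u
      least-child-fixed {u} least-u@(wu , _) = least-unique (child w) (toWitness (bit≡1F _ (begin
        bit ⌊ least? (child w) (π σ u) ⌋ ≡⟨ sym (if-¬T (≢⇒¬== πu≢r)) ⟩
        incidenceColour (π σ u) w       ≡⟨ cong (incidenceColour (π σ u)) (sym πw=w) ⟩
        incidenceColour (π σ u) (π σ w) ≡⟨ incidence-preserved (joins-sym (proj₂ (edgeBetween (child-adj wu)))) ⟩
        incidenceColour u w             ≡⟨ if-¬T (≢⇒¬== (child-≢-root wu)) ⟩
        bit ⌊ least? (child w) u ⌋      ≡⟨ if-T {b = ⌊ least? (child w) u ⌋} (fromWitness least-u) ⟩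
        1F                              ∎))) least-u
        where
        πu≢r : π σ u ≢ r
        πu≢r = child-≢-root (child-image (induced σ) root-fixed πw=w wu)

      siblings-image : ∀ {p u} → Consecutive (child w) p u → π σ p ≡ p → T (siblings w p (π σ u))
      siblings-image {p} {u} p⋯u@(wp , wu , p<u , _) πp=p =
        subst T (sym image-same) (from (T-∨ {⌊ consecutive? (child w) p u ⌋}) (inj₁ (fromWitness p⋯u)))
        where
        image-same : siblings w p (π σ u) ≡ siblings w p u
        image-same = begin
          siblings w p (π σ u)             ≡⟨ cong₂ (λ a b → siblings a b (π σ u)) (sym πw=w) (sym πp=p) ⟩
          siblings (π σ w) (π σ p) (π σ u) ≡⟨ siblings-preserved (proj₂ (edgeBetween (child-adj wp)))
                                                                  (proj₂ (edgeBetween (child-adj wu))) (<⇒≢ p<u) ⟩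
          siblings w p u                   ∎

      next-child-fixed : ∀ {p u} → Consecutive (child w) p u → π σ p ≡ p →
                         (∀ x → x < u → T (child w x) → π σ x ≡ x) → π σ u ≡ u
      next-child-fixed {p} {u} p⋯u@(_ , wu , p<u , _) πp=p earlier-fixed
        with to (T-∨ {⌊ consecutive? (child w) p (π σ u) ⌋}) (siblings-image p⋯u πp=p)
      ... | inj₁ p⋯πu = sym (consecutive-unique (child w) p⋯u (toWitness p⋯πu))
      ... | inj₂ πu⋯p with _ , _ , πu<p , _ ← toWitness {a? = consecutive? (child w) (π σ u) p} πu⋯p =
        π-injective σ (earlier-fixed (π σ u) (<-trans πu<p p<u) (child-image (induced σ) root-fixed πw=w wu))

      children-fixed : ∀ u → T (child w u) → π σ u ≡ u
      children-fixed u = fixed u (<-wellFounded u)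
        where
        fixed : ∀ u → Acc _<_ u → T (child w u) → π σ u ≡ u
        fixed u (acc earlier) wu with least? (child w) u
        ... | yes least-u = least-child-fixed least-u
        ... | no  ¬least-u with p , p⋯u@(wp , _ , p<u , _) ← predecessor (child w) wu ¬least-u =
          next-child-fixed p⋯u (fixed p (earlier p<u) wp) (λ x x<u → fixed x (earlier x<u))

    σ-identity : IsIdentity σ
    σ-identity = identity-if-vertices-fixed σ
      (fixed-if-children-fixed (induced σ) root-fixed all-within-N (λ w u πw=w → children-fixed πw=w u))

middleGraph-distinguishingIndex : ∀ {n} (G : SimpleGraph n) → Connected G → Fin n → DistIndexLE (middleAdj G) 3
middleGraph-distinguishingIndex G connected r
  with N , all-within-N ← Layers.all-within G r connected =
  colouring , σ-identity connected all-within-N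
  where open EdgeColouring G r N

-- Sharpness on the path P₃

P₃ : SimpleGraph 3
P₃ = record
  { adj    = λ u v → ∣ toℕ u - toℕ v ∣ ℕ.≡ᵇ 1
  ; sym    = λ u v → cong (ℕ._≡ᵇ 1) (ℕ.∣-∣-comm (toℕ u) (toℕ v))
  ; irrefl = λ v → cong (ℕ._≡ᵇ 1) (ℕ.∣n-n∣≡0 (toℕ v))
  }

P₃-connected : Connected P₃
P₃-connected 0F 0F = here
P₃-connected 0F 1F = step tt here
P₃-connected 0F 2F = step {y = 1F} tt (step tt here)
P₃-connected 1F 0F = step tt here
P₃-connected 1F 1F = here
P₃-connected 1F 2F = step tt here
P₃-connected 2F 0F = step {y = 1F} tt (step tt here)
P₃-connected 2F 1F = step tt here
P₃-connected 2F 2F = here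

P₃-reversal : Automorphism (adj P₃)
P₃-reversal = record
  { fun      = opposite
  ; inv      = opposite
  ; inverseˡ = opposite-involutive
  ; inverseʳ = opposite-involutive
  ; preserve = toWitness {a? = all? λ u → all? λ v → adj P₃ (opposite u) (opposite v) Bool.≟ adj P₃ u v}
                         tt
  }

middleP₃-distinguishingNumber : DistNumberEq (middleAdj P₃) (maxDegree P₃)
middleP₃-distinguishingNumber = middleGraph-distinguishingNumber P₃ P₃-connected 0F 0 ≤-refl , lower-bound
  where
  lower-bound : ∀ k → k ℕ.< 2 → ¬ DistNumberLE (middleAdj P₃) k
  lower-bound 0 _ = ¬DistNumberLE-0 (inj₁ 0F)
  lower-bound 1 _ = ¬DistNumberLE-1 (MiddleAutomorphism.lift P₃ P₃-reversal) (inj₁ 0F) (λ ())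
  lower-bound (suc (suc _)) (s≤s (s≤s ()))

theorem3p6 :
  ((n : ℕ) → 3 ≤ n → (G : SimpleGraph n) → Connected G →
     DistNumberLE (middleAdj G) (maxDegree G))
  × (∃ λ (n : ℕ) → 3 ≤ n × ∃ λ (G : SimpleGraph n) →
       Connected G × DistNumberEq (middleAdj G) (maxDegree G))
  × ((n : ℕ) → 1 ≤ n → (G : SimpleGraph n) → Connected G →
       DistIndexLE (middleAdj G) 3)
theorem3p6 =
    (λ _ 3≤n G → middleGraph-distinguishingNumber≤Δ G 3≤n)
  , (3 , ≤-refl , P₃ , P₃-connected , middleP₃-distinguishingNumber)
  , distinguishingIndex≤3
  where
  distinguishingIndex≤3 : (n : ℕ) → 1 ≤ n → (G : SimpleGraph n) → Connected G → DistIndexLE (middleAdj G) 3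
  distinguishingIndex≤3 (suc _) _ G connected = middleGraph-distinguishingIndex G connected 0F
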